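{- Let $G=(V,E)$ be a finite simple connected graph of order $n\geq 2$. Then $\alpha_0(S(G))=n=\beta_0(S(G))$ if and only if $|N(S)|\geq |S|$ for every independent set $S$ of $G$.
   Context: For a finite simple graph $G=(V,E)$, the splitting graph $S(G)$ is obtained from $G$ by adding, for each vertex $v\in V$, a new vertex $v'$, and joining $v'$ to a vertex $u\in V$ if and only if $uv\in E$ (no other edges are added). For a graph $H$, $\alpha_0(H)$ denotes the vertex cover number and $\beta_0(H)$ the independence number. For $S\subseteq V$, $N(S)$ is the set of vertices of $G$ adjacent to at least one vertex of $S$. -}

module Defs where

open import Data.Nat using (ℕ; _≤_; _≥_)
open import Data.Fin using (Fin; splitAt)
open import Data.Fin.Subset using (Subset; _∈_; ∣_∣; inside; outside)
open import Data.Vec using (tabulate)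
open import Data.Sum using (_⊎_; inj₁; inj₂)
open import Data.Product using (∃; ∃-syntax; _×_; _,_)
open import Data.Empty using (⊥)
open import Relation.Nullary using (¬_; Dec; yes; no)
open import Relation.Nullary.Decidable using (⌊_⌋)
open import Relation.Binary.PropositionalEquality using (_≡_)
open import Data.Fin.Properties using (any?)
open import Data.Fin.Subset.Properties using (_∈?_)
open import Relation.Nullary.Decidable using (_×-dec_)
open import Data.Bool using (if_then_else_)

record Graph (n : ℕ) : Set₁ where
  field
    Adj   : Fin n → Fin n → Set
    adj?  : ∀ u v → Dec (Adj u v)
    irrefl : ∀ v → ¬ Adj v v
    sym   : ∀ {u v} → Adj u v → Adj v u
open Graph public

data Reach {n : ℕ} (G : Graph n) : Fin n → Fin n → Set where
  here : ∀ {u} → Reach G u u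
  step : ∀ {u v w} → Adj G u v → Reach G v w → Reach G u w

Connected : ∀ {n} → Graph n → Set
Connected {n} G = ∀ (u v : Fin n) → Reach G u v

-- Splitting graph S(G) on Fin (n + n): the first copy is V, the second the
-- new vertices v'.  v' ~ u (u ∈ V) iff uv ∈ E; no edges among the v'.
SAdj : ∀ {n} → Graph n → Fin (n Data.Nat.+ n) → Fin (n Data.Nat.+ n) → Set
SAdj {n} G i j with splitAt n i | splitAt n j
... | inj₁ u | inj₁ v = Adj G u v
... | inj₁ u | inj₂ v = Adj G u v
... | inj₂ u | inj₁ v = Adj G u v
... | inj₂ u | inj₂ v = ⊥

SAdj? : ∀ {n} (G : Graph n) i j → Dec (SAdj G i j)
SAdj? {n} G i j with splitAt n i | splitAt n j
... | inj₁ u | inj₁ v = adj? G u v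
... | inj₁ u | inj₂ v = adj? G u v
... | inj₂ u | inj₁ v = adj? G u v
... | inj₂ u | inj₂ v = no (λ ())

SIrr : ∀ {n} (G : Graph n) v → ¬ SAdj G v v
SIrr {n} G v with splitAt n v
... | inj₁ u = irrefl G u
... | inj₂ u = λ ()

SSym : ∀ {n} (G : Graph n) {i j} → SAdj G i j → SAdj G j i
SSym {n} G {i} {j} p with splitAt n i | splitAt n j
... | inj₁ u | inj₁ v = sym G p
... | inj₁ u | inj₂ v = sym G p
... | inj₂ u | inj₁ v = sym G p

splitting : ∀ {n} → Graph n → Graph (n Data.Nat.+ n)
splitting G = record { Adj = SAdj G ; adj? = SAdj? G ; irrefl = SIrr G ; sym = SSym G }

IsVertexCover : ∀ {n} → Graph n → Subset n → Set
IsVertexCover G C = ∀ u v → Adj G u v → u ∈ C ⊎ v ∈ C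

IsIndependent : ∀ {n} → Graph n → Subset n → Set
IsIndependent G S = ∀ u v → u ∈ S → v ∈ S → ¬ Adj G u v

VertexCoverNumber : ∀ {n} → Graph n → ℕ → Set
VertexCoverNumber G k =
  (∃[ C ] (IsVertexCover G C × ∣ C ∣ ≡ k)) × (∀ C → IsVertexCover G C → k ≤ ∣ C ∣)

IndependenceNumber : ∀ {n} → Graph n → ℕ → Set
IndependenceNumber G k =
  (∃[ S ] (IsIndependent G S × ∣ S ∣ ≡ k)) × (∀ S → IsIndependent G S → ∣ S ∣ ≤ k)

nbhd : ∀ {n} → Graph n → Subset n → Subset n
nbhd {n} G S = tabulate λ u →
  if ⌊ any? (λ v → (v ∈? S) ×-dec (adj? G u v)) ⌋ then inside else outside

-- An independent set of S(G) is a pair (A , B) with A independent in G and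
-- B a set of copies v′ avoiding N(A); hence β₀(S(G)) is the maximum of
-- |A| + n − |N(A)| over independent A, which is n (attained at A = ∅) exactly
-- when |N(A)| ≥ |A| always. The vertex cover V, of size n, then gives
-- α₀(S(G)) = n, since the complement of a cover is independent.
module Submission where

open import Defs hiding (sym)
open import Data.Nat using (ℕ; _≥_; _≤_; _+_; _∸_; suc)
open import Data.Nat.Properties
  using (+-monoʳ-≤; +-cancelʳ-≤; m+[n∸m]≡n; m≤n+m∸n; m+n∸n≡m; ∸-monoʳ-≤; +-identityʳ; module ≤-Reasoning)
open import Data.Fin using (Fin; splitAt; _↑ˡ_; _↑ʳ_)
open import Data.Fin.Properties using (any?; splitAt-↑ˡ; splitAt-↑ʳ)
open import Data.Fin.Subset using (Subset; ∣_∣; _∈_; _⊆_; ∁; inside; outside; ⊤; ⊥)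
open import Data.Fin.Subset.Properties
  using (_∈?_; ∈⊤; ∣⊤∣≡n; ∣⊥∣≡0; ∣p∣≤n; p⊆q⇒∣p∣≤∣q∣; ∣∁p∣≡n∸∣p∣; x∈∁p⇒x∉p; x∉p⇒x∈∁p)
open import Data.Vec using (_∷_; []; _++_; tabulate)
import Data.Vec as Vec
open import Data.Vec.Properties using (lookup-splitAt; lookup-++ˡ; lookup-++ʳ; lookup∘tabulate; lookup⇒[]=; []=⇒lookup)
open import Data.Bool using (if_then_else_)
open import Data.Product using (_×_; _,_; ∃)
open import Data.Sum using (inj₁; inj₂; [_,_]′)
open import Relation.Nullary using (yes; no; contradiction)
open import Relation.Nullary.Decidable using (⌊_⌋; _×-dec_)
open import Relation.Unary using (Pred; Decidable)
open import Relation.Binary.PropositionalEquality using (_≡_; refl; sym; trans; cong; cong₂)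
open import Function.Bundles using (_⇔_; mk⇔)
open ≤-Reasoning

characteristic : ∀ {p n} {P : Pred (Fin n) p} → Decidable P → Subset n
characteristic P? = tabulate λ u → if ⌊ P? u ⌋ then inside else outside

∈-characteristic⁻ : ∀ {p n} {P : Pred (Fin n) p} (P? : Decidable P) {u} →
                    u ∈ characteristic P? → P u
∈-characteristic⁻ P? {u} u∈ with P? u | trans (sym (lookup∘tabulate _ u)) ([]=⇒lookup u∈)
... | yes Pu | _ = Pu
... | no _   | ()

∈-characteristic⁺ : ∀ {p n} {P : Pred (Fin n) p} (P? : Decidable P) {u} →
                    P u → u ∈ characteristic P?
∈-characteristic⁺ P? {u} Pu with P? u | lookup∘tabulate (λ x → if ⌊ P? x ⌋ then inside else outside) u
... | yes _  | eq = lookup⇒[]= u _ eq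
... | no ¬Pu | _  = contradiction Pu ¬Pu

∈-++⁻ : ∀ {m k} (A : Subset m) (B : Subset k) {i} →
        i ∈ A ++ B → [ (_∈ A) , (_∈ B) ]′ (splitAt m i)
∈-++⁻ {m} A B {i} i∈ with splitAt m i | lookup-splitAt m A B i
... | inj₁ u | eq = lookup⇒[]= u A (trans (sym eq) ([]=⇒lookup i∈))
... | inj₂ u | eq = lookup⇒[]= u B (trans (sym eq) ([]=⇒lookup i∈))

∈-++⁺ : ∀ {m k} (A : Subset m) (B : Subset k) {i} →
        [ (_∈ A) , (_∈ B) ]′ (splitAt m i) → i ∈ A ++ B
∈-++⁺ {m} A B {i} u∈ with splitAt m i | lookup-splitAt m A B i
... | inj₁ u | eq = lookup⇒[]= i (A ++ B) (trans eq ([]=⇒lookup u∈))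
... | inj₂ u | eq = lookup⇒[]= i (A ++ B) (trans eq ([]=⇒lookup u∈))

∈-++⁺ˡ : ∀ {m k} (A : Subset m) (B : Subset k) {u} → u ∈ A → u ↑ˡ k ∈ A ++ B
∈-++⁺ˡ A B {u} u∈ = lookup⇒[]= _ (A ++ B) (trans (lookup-++ˡ A B u) ([]=⇒lookup u∈))

∈-++⁺ʳ : ∀ {m k} (A : Subset m) (B : Subset k) {u} → u ∈ B → m ↑ʳ u ∈ A ++ B
∈-++⁺ʳ A B {u} u∈ = lookup⇒[]= _ (A ++ B) (trans (lookup-++ʳ A B u) ([]=⇒lookup u∈))

∣p++q∣≡∣p∣+∣q∣ : ∀ {m k} (p : Subset m) (q : Subset k) → ∣ p ++ q ∣ ≡ ∣ p ∣ + ∣ q ∣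
∣p++q∣≡∣p∣+∣q∣ []            q = refl
∣p++q∣≡∣p∣+∣q∣ (outside ∷ p) q = ∣p++q∣≡∣p∣+∣q∣ p q
∣p++q∣≡∣p∣+∣q∣ (inside ∷ p)  q = cong suc (∣p++q∣≡∣p∣+∣q∣ p q)

IndependentSetsBoundedBy : ∀ {m} → Graph m → ℕ → Set
IndependentSetsBoundedBy H k = ∀ I → IsIndependent H I → ∣ I ∣ ≤ k

HallCondition : ∀ {n} → Graph n → Set
HallCondition G = ∀ S → IsIndependent G S → ∣ nbhd G S ∣ ≥ ∣ S ∣

module _ {m : ℕ} (H : Graph m) where

  ∁-cover-independent : ∀ C → IsVertexCover H C → IsIndependent H (∁ C)
  ∁-cover-independent C cover u v u∉C v∉C uv with cover u v uv
  ... | inj₁ u∈C = x∈∁p⇒x∉p u∉C u∈C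
  ... | inj₂ v∈C = x∈∁p⇒x∉p v∉C v∈C

  order≤∣cover∣+bound : ∀ {k C} → IndependentSetsBoundedBy H k → IsVertexCover H C → m ≤ ∣ C ∣ + k
  order≤∣cover∣+bound {k} {C} bounded cover = begin
    m                    ≤⟨ m≤n+m∸n m ∣ C ∣ ⟩
    ∣ C ∣ + (m ∸ ∣ C ∣)  ≡⟨ cong (∣ C ∣ +_) (∣∁p∣≡n∸∣p∣ C) ⟨
    ∣ C ∣ + ∣ ∁ C ∣      ≤⟨ +-monoʳ-≤ ∣ C ∣ (bounded (∁ C) (∁-cover-independent C cover)) ⟩
    ∣ C ∣ + k            ∎

firstCopy : ∀ n → Subset (n + n)
firstCopy n = ⊤ {n} ++ ⊥ {n}

∣firstCopy∣≡n : ∀ n → ∣ firstCopy n ∣ ≡ n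
∣firstCopy∣≡n n = trans (∣p++q∣≡∣p∣+∣q∣ (⊤ {n}) (⊥ {n})) (trans (cong₂ _+_ (∣⊤∣≡n n) (∣⊥∣≡0 n)) (+-identityʳ n))

∣∁firstCopy∣≡n : ∀ n → ∣ ∁ (firstCopy n) ∣ ≡ n
∣∁firstCopy∣≡n n = trans (∣∁p∣≡n∸∣p∣ (firstCopy n)) (trans (cong (n + n ∸_) (∣firstCopy∣≡n n)) (m+n∸n≡m n n))

module _ {n : ℕ} (G : Graph n) where

  ∈-nbhd⁺ : ∀ {S u v} → v ∈ S → Adj G u v → u ∈ nbhd G S
  ∈-nbhd⁺ {S} v∈S uv = ∈-characteristic⁺ (λ u → any? λ v → (v ∈? S) ×-dec adj? G u v) (_ , v∈S , uv)

  ∈-nbhd⁻ : ∀ {S u} → u ∈ nbhd G S → ∃ λ v → v ∈ S × Adj G u v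
  ∈-nbhd⁻ {S} = ∈-characteristic⁻ (λ u → any? λ v → (v ∈? S) ×-dec adj? G u v)

  splitting-adj-↑ˡ↑ˡ : ∀ {u v} → Adj G u v → SAdj G (u ↑ˡ n) (v ↑ˡ n)
  splitting-adj-↑ˡ↑ˡ {u} {v} uv rewrite splitAt-↑ˡ n u n | splitAt-↑ˡ n v n = uv

  splitting-adj-↑ʳ↑ˡ : ∀ {u v} → Adj G u v → SAdj G (n ↑ʳ u) (v ↑ˡ n)
  splitting-adj-↑ʳ↑ˡ {u} {v} uv rewrite splitAt-↑ʳ n n u | splitAt-↑ˡ n v n = uv

  firstCopy-covers : IsVertexCover (splitting G) (firstCopy n)
  firstCopy-covers i j with splitAt n i | ∈-++⁺ (⊤ {n}) (⊥ {n}) {i} | splitAt n j | ∈-++⁺ (⊤ {n}) (⊥ {n}) {j}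
  ... | inj₁ _ | i∈ | _      | _  = λ _ → inj₁ (i∈ ∈⊤)
  ... | inj₂ _ | _  | inj₁ _ | j∈ = λ _ → inj₂ (j∈ ∈⊤)
  ... | inj₂ _ | _  | inj₂ _ | _  = λ ()

  splitting-independent⁺ : ∀ {A B} → IsIndependent G A → B ⊆ ∁ (nbhd G A) →
                           IsIndependent (splitting G) (A ++ B)
  splitting-independent⁺ {A} {B} indA B⊆ i j i∈ j∈ ij
    with splitAt n i | ∈-++⁻ A B i∈ | splitAt n j | ∈-++⁻ A B j∈
  ... | inj₁ u | u∈A | inj₁ v | v∈A = indA u v u∈A v∈A ij
  ... | inj₁ u | u∈A | inj₂ v | v∈B = x∈∁p⇒x∉p (B⊆ v∈B) (∈-nbhd⁺ u∈A (Graph.sym G ij))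
  ... | inj₂ u | u∈B | inj₁ v | v∈A = x∈∁p⇒x∉p (B⊆ u∈B) (∈-nbhd⁺ v∈A ij)

  splitting-independent⁻ : ∀ {A B} → IsIndependent (splitting G) (A ++ B) →
                           IsIndependent G A × B ⊆ ∁ (nbhd G A)
  splitting-independent⁻ {A} {B} ind =
      (λ u v u∈A v∈A uv → ind _ _ (∈-++⁺ˡ A B u∈A) (∈-++⁺ˡ A B v∈A) (splitting-adj-↑ˡ↑ˡ uv))
    , λ u∈B → x∉p⇒x∈∁p λ u∈N → let (v , v∈A , uv) = ∈-nbhd⁻ u∈N in
        ind _ _ (∈-++⁺ʳ A B u∈B) (∈-++⁺ˡ A B v∈A) (splitting-adj-↑ʳ↑ˡ uv)

  hall⇒splitting-bounded : HallCondition G → IndependentSetsBoundedBy (splitting G) n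
  hall⇒splitting-bounded hall I indI with Vec.splitAt n I
  ... | A , B , refl with splitting-independent⁻ indI
  ... | indA , B⊆ = begin
    ∣ A ++ B ∣                  ≡⟨ ∣p++q∣≡∣p∣+∣q∣ A B ⟩
    ∣ A ∣ + ∣ B ∣               ≤⟨ +-monoʳ-≤ ∣ A ∣ (p⊆q⇒∣p∣≤∣q∣ B⊆) ⟩
    ∣ A ∣ + ∣ ∁ (nbhd G A) ∣    ≡⟨ cong (∣ A ∣ +_) (∣∁p∣≡n∸∣p∣ (nbhd G A)) ⟩
    ∣ A ∣ + (n ∸ ∣ nbhd G A ∣)  ≤⟨ +-monoʳ-≤ ∣ A ∣ (∸-monoʳ-≤ n (hall A indA)) ⟩
    ∣ A ∣ + (n ∸ ∣ A ∣)         ≡⟨ m+[n∸m]≡n (∣p∣≤n A) ⟩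
    n                           ∎

  splitting-bounded⇒hall : IndependentSetsBoundedBy (splitting G) n → HallCondition G
  splitting-bounded⇒hall bounded A indA = +-cancelʳ-≤ (n ∸ ∣ N ∣) ∣ A ∣ ∣ N ∣ (begin
    ∣ A ∣ + (n ∸ ∣ N ∣)  ≡⟨ cong (∣ A ∣ +_) (∣∁p∣≡n∸∣p∣ N) ⟨
    ∣ A ∣ + ∣ ∁ N ∣      ≡⟨ ∣p++q∣≡∣p∣+∣q∣ A (∁ N) ⟨
    ∣ A ++ ∁ N ∣         ≤⟨ bounded (A ++ ∁ N) (splitting-independent⁺ indA (λ x → x)) ⟩
    n                    ≡⟨ m+[n∸m]≡n (∣p∣≤n N) ⟨
    ∣ N ∣ + (n ∸ ∣ N ∣)  ∎)
    where N = nbhd G A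

corollary2 : (n : ℕ) → n ≥ 2 → (G : Graph n) → Connected G →
    (VertexCoverNumber (splitting G) n × IndependenceNumber (splitting G) n)
      ⇔ (∀ (S : Subset n) → IsIndependent G S → ∣ nbhd G S ∣ ≥ ∣ S ∣)
corollary2 n _ G _ = mk⇔ (λ (_ , _ , bounded) → splitting-bounded⇒hall G bounded) from
  where
    from : HallCondition G → VertexCoverNumber (splitting G) n × IndependenceNumber (splitting G) n
    from hall =
        ( (firstCopy n , firstCopy-covers G , ∣firstCopy∣≡n n)
        , λ C cover → +-cancelʳ-≤ n n ∣ C ∣ (order≤∣cover∣+bound (splitting G) bounded cover) )
      , ( (∁ (firstCopy n) , ∁-cover-independent (splitting G) _ (firstCopy-covers G) , ∣∁firstCopy∣≡n n)
        , bounded )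
      where bounded = hall⇒splitting-bounded G hall
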